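{- Let $S$ be a context-free closed semi-Thue system over $\Sigma$. If $\Gamma$ is an $S$-stable nested sequent, then there exists a $\Sigma$-model $\mathfrak M$ such that for every node $x$ of $\Gamma$ and every formula $A\in\Gamma|x$ there exists a world $w$ of $\mathfrak M$ with $\mathfrak M,w\not\models A$.
   Context: $\Sigma$: alphabet with involution $a\mapsto\bar a$; $\overline{a_1\cdots a_n}=\bar a_n\cdots\bar a_1$. Semi-Thue system $S$: rules $u\to v$; closed if $u\to v\in S\Rightarrow\bar u\to\bar v\in S$; context-free: all rules $a\to u$, $a\in\Sigma$; $L_a(S)=\{u\mid a\Rightarrow_S u\}$. A $\Sigma$-model $\langle W,\{R_a\},V\rangle$: $W\ne\emptyset$, $R_a=\{(x,y)\mid(y,x)\in R_{\bar a}\}$, $V$ a valuation; truth standard. Formulae are in negation normal form; $\sim\! A$ is the nnf of $\neg A$. A nested sequent is a finite multiset of formulae and structures $a\{\Delta\}$, viewed as a tree: nodes carry multisets of formulae ($\Gamma|i$ for node $i$), edges are $\Sigma$-labelled, $i\xrightarrow{a}j$ means $j$ is an $a$-child of $i$. A propagation automaton is an FSA $(\Sigma,Q,\{i\},\{j\},\delta)$ with a single initial and a single final state such that $k\xrightarrow{a}l\in\delta$ implies $l\xrightarrow{\bar a}k\in\delta$; it is identified with its language. $\mathcal R(\Gamma,i,j)$: states the nodes of $\Gamma$, initial $i$, final $j$, transitions $x\xrightarrow{a}y$ and $y\xrightarrow{\bar a}x$ for each edge $x\xrightarrow{a}y$. For state lists $\vec i=i_1..i_n$, $\vec j=j_1..j_n$,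 $\mathcal P[\vec i:=\vec j]$ is obtained by replacing each $i_m$ by $j_m$ in the state set, initial/final states and transitions. $\Gamma$ is $(S,\mathcal P)$-propagated for $\mathcal P=(\Sigma,Q,\{i\},\{j\},\delta)$ ($Q$ a set of nodes) if $\langle a\rangle A\in\Gamma|i$ and $\mathcal P\cap L_a(S)\ne\emptyset$ imply $A\in\Gamma|j$; $S$-propagated if $(S,\mathcal R(\Gamma,i,j))$-propagated for all nodes $i,j$. Node $i$ saturated: $A\in\Gamma|i\Rightarrow\sim\! A\notin\Gamma|i$; $A\lor B\in\Gamma|i\Rightarrow A,B\in\Gamma|i$; $A\land B\in\Gamma|i\Rightarrow A$ or $B\in\Gamma|i$. Realised: $[a]A\in\Gamma|i\Rightarrow A\in\Gamma|j$ for some $i\xrightarrow{a}j$. $\Gamma$ is $S$-stable if: every node is saturated; $\Gamma$ is $S$-propagated; every internal node is realised; and, with $\vec x=x_1..x_n$ the list of all unrealised leaves, there is $\lambda$ assigning each $x_m$ an ancestor $\lambda(x_m)$ with $\Gamma|x_m=\Gamma|\lambda(x_m)$ such that for all nodes $y,z$, $\Gamma$ is $(S,\mathcal R(\Gamma,y,z)[\vec x:=\lambda(\vec x)])$-propagated. -}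

module Defs where

open import Data.Nat using (ℕ)
open import Data.List using (List; []; _∷_; _++_; reverse; map)
open import Data.List.Membership.Propositional using (_∈_; _∉_)
open import Data.List.Relation.Binary.Permutation.Propositional using (_↭_)
open import Data.Product using (Σ; Σ-syntax; ∃; ∃₂; _×_; _,_)
open import Data.Sum using (_⊎_)
open import Relation.Binary.PropositionalEquality using (_≡_)
open import Relation.Nullary using (¬_)
open import Relation.Binary.Construct.Closure.ReflexiveTransitive using (Star)
open import Relation.Binary.Construct.Closure.Transitive using (TransClosure)

record Alphabet : Set₁ where
  field
    Letter    : Set
    bar       : Letter → Letter
    bar-invol : ∀ a → bar (bar a) ≡ a

module _ (𝔄 : Alphabet) where
  open Alphabet 𝔄

  Word : Set
  Word = List Letter

  barW : Word → Word
  barW w = reverse (map bar w)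

  SemiThue : Set₁
  SemiThue = Word → Word → Set

  Closed : SemiThue → Set
  Closed S = ∀ u v → S u v → S (barW u) (barW v)

  ContextFree : SemiThue → Set
  ContextFree S = ∀ u v → S u v → ∃ λ a → u ≡ a ∷ []

  data Step (S : SemiThue) : Word → Word → Set where
    step : ∀ x u v y → S u v → Step S (x ++ u ++ y) (x ++ v ++ y)

  L : SemiThue → Letter → Word → Set
  L S a u = Star (Step S) (a ∷ []) u

  infixr 6 _∧_
  infixr 5 _∨_
  data Fm : Set where
    atom  : ℕ → Fm
    natom : ℕ → Fm
    _∧_   : Fm → Fm → Fm
    _∨_   : Fm → Fm → Fm
    ⟨_⟩_  : Letter → Fm → Fm
    [_]_  : Letter → Fm → Fm

  ~ : Fm → Fm
  ~ (atom p)    = natom p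
  ~ (natom p)   = atom p
  ~ (A ∧ B)     = ~ A ∨ ~ B
  ~ (A ∨ B)     = ~ A ∧ ~ B
  ~ (⟨ a ⟩ A)   = [ a ] ~ A
  ~ ([ a ] A)   = ⟨ a ⟩ ~ A

  record Model : Set₁ where
    field
      W      : Set
      w₀     : W                    -- W ≠ ∅
      R      : Letter → W → W → Set
      R-conv : ∀ a x y → (R a x y → R (bar a) y x) × (R (bar a) y x → R a x y)
      V      : ℕ → W → Set

  Sat : (M : Model) → Model.W M → Fm → Set
  Sat M w (atom p)  = Model.V M p w
  Sat M w (natom p) = ¬ Model.V M p w
  Sat M w (A ∧ B)   = Sat M w A × Sat M w B
  Sat M w (A ∨ B)   = Sat M w A ⊎ Sat M w B
  Sat M w (⟨ a ⟩ A) = ∃ λ v → Model.R M a w v × Sat M v A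
  Sat M w ([ a ] A) = ∀ v → Model.R M a w v → Sat M v A

  -- Nested sequents as trees: a multiset (list) of formulae and
  -- a multiset (list) of labelled children a{Δ}.
  data NSeq : Set where
    node : List Fm → List (Letter × NSeq) → NSeq

  -- nodes of a nested sequent (positions in the tree)
  data Pos : NSeq → Set where
    here : ∀ {Fs cs} → Pos (node Fs cs)
    down : ∀ {Fs cs a Δ} → (a , Δ) ∈ cs → Pos Δ → Pos (node Fs cs)

  label : (Γ : NSeq) → Pos Γ → List Fm
  label (node Fs cs) here                = Fs
  label (node Fs cs) (down {Δ = Δ} m p)  = label Δ p

  data Edge : (Γ : NSeq) → Pos Γ → Letter → Pos Γ → Set where
    top    : ∀ {Fs cs a Gs ds} (m : (a , node Gs ds) ∈ cs) →
             Edge (node Fs cs) here a (down m here)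
    deeper : ∀ {Fs cs a b Δ} (m : (b , Δ) ∈ cs) {x y : Pos Δ} →
             Edge Δ x a y → Edge (node Fs cs) (down m x) a (down m y)

  Parent : (Γ : NSeq) → Pos Γ → Pos Γ → Set
  Parent Γ x y = ∃ λ a → Edge Γ x a y

  StrictAncestor : (Γ : NSeq) → Pos Γ → Pos Γ → Set
  StrictAncestor Γ = TransClosure (Parent Γ)

  record Automaton (Q : Set) : Set₁ where
    field
      init  : Q
      final : Q
      δ     : Q → Letter → Q → Set

  data Run {Q : Set} (P : Automaton Q) : Q → Word → Q → Set where
    nil  : ∀ {q} → Run P q [] q
    cons : ∀ {q a r w s} → Automaton.δ P q a r → Run P r w s → Run P q (a ∷ w) s

  Accepts : {Q : Set} → Automaton Q → Word → Set
  Accepts P w = Run P (Automaton.init P) w (Automaton.final P)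

  𝓡 : (Γ : NSeq) → Pos Γ → Pos Γ → Automaton (Pos Γ)
  𝓡 Γ i j = record
    { init = i ; final = j
    ; δ = λ x a y → Edge Γ x a y ⊎ Edge Γ y (bar a) x }

  -- P[x⃗ := f x⃗]  (f is the identity outside x⃗)
  rename : {Q : Set} → (Q → Q) → Automaton Q → Automaton Q
  rename f P = record
    { init = f (Automaton.init P) ; final = f (Automaton.final P)
    ; δ = λ u a v → ∃₂ λ x y → f x ≡ u × f y ≡ v × Automaton.δ P x a y }

  Propagated : SemiThue → (Γ : NSeq) → Automaton (Pos Γ) → Set
  Propagated S Γ P = ∀ a A → (⟨ a ⟩ A) ∈ label Γ (Automaton.init P) →
    (∃ λ w → L S a w × Accepts P w) → A ∈ label Γ (Automaton.final P)

  SPropagated : SemiThue → NSeq → Set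
  SPropagated S Γ = ∀ i j → Propagated S Γ (𝓡 Γ i j)

  Saturated : (Γ : NSeq) → Pos Γ → Set
  Saturated Γ i =
    (∀ A → A ∈ label Γ i → ~ A ∉ label Γ i) ×
    (∀ A B → (A ∨ B) ∈ label Γ i → A ∈ label Γ i × B ∈ label Γ i) ×
    (∀ A B → (A ∧ B) ∈ label Γ i → A ∈ label Γ i ⊎ B ∈ label Γ i)

  Realised : (Γ : NSeq) → Pos Γ → Set
  Realised Γ i = ∀ a A → ([ a ] A) ∈ label Γ i →
    ∃ λ j → Edge Γ i a j × A ∈ label Γ j

  Internal : (Γ : NSeq) → Pos Γ → Set
  Internal Γ i = ∃₂ λ a j → Edge Γ i a j

  Leaf : (Γ : NSeq) → Pos Γ → Set
  Leaf Γ i = ¬ Internal Γ i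

  UnrealisedLeaf : (Γ : NSeq) → Pos Γ → Set
  UnrealisedLeaf Γ i = Leaf Γ i × ¬ Realised Γ i

  Stable : SemiThue → NSeq → Set
  Stable S Γ =
    (∀ i → Saturated Γ i) ×
    SPropagated S Γ ×
    (∀ i → Internal Γ i → Realised Γ i) ×
    (Σ[ λ′ ∈ (Pos Γ → Pos Γ) ]
       (∀ x → UnrealisedLeaf Γ x →
          StrictAncestor Γ (λ′ x) x × label Γ x ↭ label Γ (λ′ x)) ×
       (∀ x → ¬ UnrealisedLeaf Γ x → λ′ x ≡ x) ×
       (∀ y z → Propagated S Γ (rename λ′ (𝓡 Γ y z))))

-- The countermodel is canonical: its worlds are the nodes of Γ, an atom p holds
-- at x iff p ∉ Γ|x, and x R_a y iff every ⟨a⟩A ∈ Γ|x has A ∈ Γ|y and every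
-- ⟨ā⟩A ∈ Γ|y has A ∈ Γ|x. The truth lemma "A ∈ Γ|x ⇒ x ⊭ A" goes by induction
-- on A; saturation handles the propositional cases and the definition of R the
-- diamonds. A box [a]A at a realised node is witnessed by an a-child; at an
-- unrealised leaf x it is witnessed by the a-child j of the ancestor λ(x) that
-- realises it, and propagation through the automata R(Γ,y,z)[x⃗ := λ(x⃗)] makes
-- j an R_a-successor of x. The conclusion is negative, so it may be proved
-- classically, by deciding whether a node is an unrealised leaf.
module Submission where

open import Defs
open import Data.Product using (Σ-syntax; ∃; _,_; _×_; proj₁; proj₂)
open import Data.Sum using (inj₁; inj₂)
open import Data.List using (List; []; _∷_)
open import Data.List.Membership.Propositional using (_∈_; _∉_)
open import Data.List.Relation.Binary.Permutation.Propositional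
  using (_↭_; ↭-refl; ↭-sym; ↭-trans)
open import Data.List.Relation.Binary.Permutation.Propositional.Properties using (∈-resp-↭)
open import Relation.Nullary using (¬_; Dec; yes; no)
open import Relation.Nullary.Negation using (¬¬-Monad; ¬¬-map)
open import Relation.Nullary.Decidable using (¬¬-excluded-middle)
open import Relation.Binary.PropositionalEquality using (_≡_; refl; sym; subst)
open import Relation.Binary.Construct.Closure.ReflexiveTransitive using (ε)
import Relation.Binary.Construct.Closure.Transitive as TC
open import Level using (0ℓ)
open import Effect.Monad using (RawMonad)
open RawMonad (¬¬-Monad {0ℓ}) using (_>>=_; _<&>_; pure)

module _ (𝔄 : Alphabet) where
  open Alphabet 𝔄
  open Automaton

  private
    variable
      Γ : NSeq 𝔄
      a : Letter
      A : Fm 𝔄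

  infix 8 _∣_
  _∣_ : (Γ : NSeq 𝔄) → Pos 𝔄 Γ → List (Fm 𝔄)
  _∣_ = label 𝔄

  root : (Γ : NSeq 𝔄) → Pos 𝔄 Γ
  root (node _ _) = here

  strictAncestor⇒internal : ∀ {x y} → StrictAncestor 𝔄 Γ x y → Internal 𝔄 Γ x
  strictAncestor⇒internal TC.[ a , e ]      = a , _ , e
  strictAncestor⇒internal ((a , e) TC.∷ _) = a , _ , e

  DiamondsPropagate : (Γ : NSeq 𝔄) → Letter → Pos 𝔄 Γ → Pos 𝔄 Γ → Set
  DiamondsPropagate Γ a x y = ∀ A → (⟨ a ⟩ A) ∈ Γ ∣ x → A ∈ Γ ∣ y

  CanonicalR : (Γ : NSeq 𝔄) → Letter → Pos 𝔄 Γ → Pos 𝔄 Γ → Set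
  CanonicalR Γ a x y = DiamondsPropagate Γ a x y × DiamondsPropagate Γ (bar a) y x

  module _ {x y : Pos 𝔄 Γ} where

    canonicalR-conv : CanonicalR Γ a x y → CanonicalR Γ (bar a) y x
    canonicalR-conv {a = a} (x→y , y→x) =
      y→x , subst (λ b → DiamondsPropagate Γ b x y) (sym (bar-invol a)) x→y

    canonicalR-conv⁻ : CanonicalR Γ (bar a) y x → CanonicalR Γ a x y
    canonicalR-conv⁻ {a = a} (y→x , x→y) =
      subst (λ b → DiamondsPropagate Γ b x y) (bar-invol a) x→y , y→x

  canonicalModel : NSeq 𝔄 → Model 𝔄
  canonicalModel Γ = record
    { W      = Pos 𝔄 Γ
    ; w₀     = root Γ
    ; R      = CanonicalR Γ
    ; R-conv = λ _ _ _ → canonicalR-conv {Γ = Γ} , canonicalR-conv⁻ {Γ = Γ}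
    ; V      = λ p x → atom p ∉ Γ ∣ x
    }

  canonicalR-resp-↭ : ∀ {x x′ y y′ : Pos 𝔄 Γ} →
    Γ ∣ x ↭ Γ ∣ x′ → Γ ∣ y ↭ Γ ∣ y′ → CanonicalR Γ a x y → CanonicalR Γ a x′ y′
  canonicalR-resp-↭ x↭x′ y↭y′ (x→y , y→x) =
    (λ A m → ∈-resp-↭ y↭y′ (x→y A (∈-resp-↭ (↭-sym x↭x′) m))) ,
    (λ A m → ∈-resp-↭ x↭x′ (y→x A (∈-resp-↭ (↭-sym y↭y′) m)))

  -- a ∈ L_a(S) by reflexivity of ⇒*_S, so a single transition is an accepted word.
  transition-propagates : ∀ {S} (P : Automaton 𝔄 (Pos 𝔄 Γ)) → Propagated 𝔄 S Γ P →
    δ P (init P) a (final P) → DiamondsPropagate Γ a (init P) (final P)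
  transition-propagates {a = a} P propagated t A m =
    propagated a A m (a ∷ [] , ε , cons t nil)

  module TruthLemma
    (S : SemiThue 𝔄) (Γ : NSeq 𝔄)
    (saturated : ∀ i → Saturated 𝔄 Γ i)
    (sPropagated : SPropagated 𝔄 S Γ)
    (internal⇒realised : ∀ i → Internal 𝔄 Γ i → Realised 𝔄 Γ i)
    (λ′ : Pos 𝔄 Γ → Pos 𝔄 Γ)
    (λ′-unrealisedLeaf : ∀ x → UnrealisedLeaf 𝔄 Γ x →
                           StrictAncestor 𝔄 Γ (λ′ x) x × Γ ∣ x ↭ Γ ∣ λ′ x)
    (λ′-fixes : ∀ x → ¬ UnrealisedLeaf 𝔄 Γ x → λ′ x ≡ x)
    (λ′-propagated : ∀ y z → Propagated 𝔄 S Γ (rename 𝔄 λ′ (𝓡 𝔄 Γ y z)))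
    where

    private
      variable
        x y : Pos 𝔄 Γ

    reverseEdge : Edge 𝔄 Γ x a y → Edge 𝔄 Γ x (bar (bar a)) y
    reverseEdge {x} {a} {y} = subst (λ b → Edge 𝔄 Γ x b y) (sym (bar-invol a))

    edge⇒canonicalR : Edge 𝔄 Γ x a y → CanonicalR Γ a x y
    edge⇒canonicalR e =
      transition-propagates (𝓡 𝔄 Γ _ _) (sPropagated _ _) (inj₁ e) ,
      transition-propagates (𝓡 𝔄 Γ _ _) (sPropagated _ _) (inj₂ (reverseEdge e))

    renamedEdge⇒canonicalR : Edge 𝔄 Γ x a y → CanonicalR Γ a (λ′ x) (λ′ y)
    renamedEdge⇒canonicalR {x} {a} {y} e =
      transition-propagates (rename 𝔄 λ′ (𝓡 𝔄 Γ x y)) (λ′-propagated x y)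
        (x , y , refl , refl , inj₁ e) ,
      transition-propagates (rename 𝔄 λ′ (𝓡 𝔄 Γ y x)) (λ′-propagated y x)
        (y , x , refl , refl , inj₂ (reverseEdge e))

    label-λ′ : ∀ x → ¬ ¬ (Γ ∣ x ↭ Γ ∣ λ′ x)
    label-λ′ x = ¬¬-map by-cases ¬¬-excluded-middle
      where
      by-cases : Dec (UnrealisedLeaf 𝔄 Γ x) → Γ ∣ x ↭ Γ ∣ λ′ x
      by-cases (yes ul) = proj₂ (λ′-unrealisedLeaf x ul)
      by-cases (no ¬ul) = subst (λ z → Γ ∣ x ↭ Γ ∣ z) (sym (λ′-fixes x ¬ul)) ↭-refl

    ¬unrealisedLeaf⇒realised : ¬ UnrealisedLeaf 𝔄 Γ x → ¬ ¬ Realised 𝔄 Γ x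
    ¬unrealisedLeaf⇒realised {x} ¬ul ¬realised =
      ¬ul ((λ internal → ¬realised (internal⇒realised x internal)) , ¬realised)

    box-witness : ([ a ] A) ∈ Γ ∣ x → ¬ ¬ (∃ λ j → CanonicalR Γ a x j × A ∈ Γ ∣ j)
    box-witness {x = x} m = ¬¬-excluded-middle >>= λ where
      (no ¬ul) → ¬unrealisedLeaf⇒realised ¬ul <&> λ realised →
        let (j , e , A∈j) = realised _ _ m in j , edge⇒canonicalR e , A∈j
      (yes ul) →
        let (ancestor , x↭λx) = λ′-unrealisedLeaf x ul
            (j , e , A∈j) = internal⇒realised (λ′ x) (strictAncestor⇒internal ancestor)
                              _ _ (∈-resp-↭ x↭λx m)
        in do λx↭λλx ← label-λ′ (λ′ x)
              j↭λj ← label-λ′ j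
              pure (j , canonicalR-resp-↭ {Γ = Γ} (↭-sym (↭-trans x↭λx λx↭λλx)) (↭-sym j↭λj)
                          (renamedEdge⇒canonicalR e) , A∈j)

    truth : A ∈ Γ ∣ x → ¬ Sat 𝔄 (canonicalModel Γ) x A
    truth {atom p}    m p∉x = p∉x m
    truth {natom p} {x} m ¬p∉x = ¬p∉x (proj₁ (saturated x) (natom p) m)
    truth {A ∨ B} {x} m (inj₁ ⊨A) = truth (proj₁ (proj₁ (proj₂ (saturated x)) A B m)) ⊨A
    truth {A ∨ B} {x} m (inj₂ ⊨B) = truth (proj₂ (proj₁ (proj₂ (saturated x)) A B m)) ⊨B
    truth {A ∧ B} {x} m (⊨A , ⊨B) with proj₂ (proj₂ (saturated x)) A B m
    ... | inj₁ A∈x = truth A∈x ⊨A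
    ... | inj₂ B∈x = truth B∈x ⊨B
    truth {⟨ a ⟩ A} m (v , (x→v , _) , ⊨A) = truth (x→v A m) ⊨A
    truth {[ a ] A} m ⊨□A = box-witness m λ (j , x→j , A∈j) → truth A∈j (⊨□A j x→j)

lemma6p9 : (𝔄 : Alphabet) (S : SemiThue 𝔄) → ContextFree 𝔄 S → Closed 𝔄 S →
    (Γ : NSeq 𝔄) → Stable 𝔄 S Γ →
    Σ[ M ∈ Model 𝔄 ] (∀ (x : Pos 𝔄 Γ) (A : Fm 𝔄) → A ∈ label 𝔄 Γ x →
      ∃ λ (w : Model.W M) → ¬ Sat 𝔄 M w A)
lemma6p9 𝔄 S _ _ Γ
  (saturated , sPropagated , internal⇒realised , λ′ , λ′-ul , λ′-fixes , λ′-propagated) =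
  canonicalModel 𝔄 Γ , λ x A A∈x → x , truth A∈x
  where
  open TruthLemma 𝔄 S Γ saturated sPropagated internal⇒realised λ′ λ′-ul λ′-fixes λ′-propagated
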